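{- Let $\beta\in S_n$ be a transposition. Then (1) $c(0,\beta)=2(n-2)!$ for $n>1$; (2) $c(3,\beta)=4(n-2)(n-2)!$ for $n>1$; (3) $c(4,\beta)=(n-2)(n-3)(n-2)!$ for $n>2$; (4) $c(k,\beta)=0$ for $5\le k\le n$.
   Context: $c(k,\beta)$ is the number of $\alpha\in S_n$ with $H(\alpha\beta,\beta\alpha)=k$, where $H(\sigma,\tau)=|\{a\in[n]:\sigma(a)\ne\tau(a)\}|$ is the Hamming metric on $S_n$. -}

module Defs where

open import Data.Nat using (ℕ; zero; suc)
open import Data.Fin using (Fin; _≟_)
open import Data.Vec using (Vec; []; _∷_; lookup; toList)
open import Data.List using (List; []; _∷_; map; concatMap; filter; length; allFin)
open import Data.Bool using (Bool; true; false; if_then_else_)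
open import Relation.Nullary using (does; ¬_)
open import Relation.Binary.PropositionalEquality using (_≡_)
import Data.List.Relation.Unary.Unique.DecPropositional as UniqueDec
open import Function using (_∘_)

vecsOver : {A : Set} → List A → (m : ℕ) → List (Vec A m)
vecsOver xs zero    = [] ∷ []
vecsOver xs (suc m) = concatMap (λ x → map (x ∷_) (vecsOver xs m)) xs

-- The symmetric group S_n, enumerated (without repetition) as the list of
-- one-line notations (α(0), …, α(n-1)) with pairwise distinct entries.
-- An element v denotes the permutation a ↦ lookup v a.
Sym : (n : ℕ) → List (Vec (Fin n) n)
Sym n = filter (λ v → UniqueDec.unique? _≟_ (toList v)) (vecsOver (allFin n) n)

hamming : {n : ℕ} → (Fin n → Fin n) → (Fin n → Fin n) → ℕ
hamming {n} σ τ = length (filter (λ a → Relation.Nullary.¬? (σ a ≟ τ a)) (allFin n))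
  where import Relation.Nullary

-- c(k,β) = #{α ∈ S_n : H(αβ, βα) = k}, with (αβ)(a) = α(β(a)).
c : {n : ℕ} → ℕ → (Fin n → Fin n) → ℕ
c {n} k β = length (filter (λ v → Data.Nat._≟_ (hamming (α v ∘ β) (β ∘ α v)) k) (Sym n))
  where
    import Data.Nat
    α : Vec (Fin n) n → Fin n → Fin n
    α v = lookup v

-- Write β = (i j). For a permutation α, H(αβ, βα) depends only on the pair (α i, α j), and
-- every ordered pair of distinct values is taken by exactly (n − 2)! permutations, so
-- c(k, β) = (n − 2)! · #{(x, y) : x ≠ y, H = k}. The value is 0 for (i, j) and (j, i),
-- 3 when exactly one of x, y lies in {i, j} (4(n − 2) pairs), and 4 when neither does
-- ((n − 2)(n − 3) pairs). The (n − 2)! comes from counting vectors with distinct entries over a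
-- repetition-free list with prescribed entries at two positions, one coordinate at a time.

module Submission where

open import Defs
open import Data.Bool using (Bool; true; false; not; _∧_)
open import Data.Bool.Properties using (∧-conicalˡ; ∧-conicalʳ)
open import Data.Empty using (⊥-elim)
open import Data.Fin using (Fin; zero; suc; _≟_; punchOut)
open import Data.Fin.Permutation.Components using (transpose)
open import Data.Fin.Properties using (any?; injective⇒≤; punchOut-injective)
open import Data.List using (List; []; _∷_; map; concatMap; filter; filterᵇ; length; allFin; _++_)
open import Data.List.Properties using (map-tabulate; length-tabulate)
import Data.List.Relation.Unary.All as All
import Data.List.Relation.Unary.Unique.DecPropositional as UniqueDec
open import Data.Nat using (ℕ; zero; suc; _+_; _*_; _∸_; _!; _≤_; _<_; _>_; s≤s; z≤n)
open import Data.Nat.Properties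
  using (+-identityʳ; +-assoc; +-comm; *-identityˡ; *-identityʳ; *-zeroʳ; *-comm; *-assoc;
         *-distribˡ-+; *-distribʳ-+; ∸-+-assoc; m+n∸n≡m; m+n∸m≡n; m*n≡1⇒m≡1; m*n≡1⇒n≡1;
         n≮n; 1+n≰n; ≤-trans; +-commutativeSemigroup; *-commutativeSemigroup)
  renaming (_≟_ to _≟ℕ_)
open import Data.Nat.Tactic.RingSolver using (solve-∀)
open import Algebra.Properties.CommutativeSemigroup +-commutativeSemigroup
  using () renaming (interchange to +-interchange)
open import Algebra.Properties.CommutativeSemigroup *-commutativeSemigroup
  using () renaming (x∙yz≈y∙xz to x*yz≡y*xz)
open import Data.Product using (_×_; _,_; ∃; proj₁; proj₂)
open import Data.Sum using (_⊎_; inj₁; inj₂)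
open import Data.Vec using (Vec; []; _∷_; lookup; toList)
open import Function using (_∘_; id)
open import Function.Definitions using (Injective)
open import Relation.Nullary using (Dec; yes; no; does; ¬?)
open import Relation.Nullary.Decidable using (dec-true; dec-false)
open import Relation.Unary using (Pred; Decidable)
open import Relation.Binary.PropositionalEquality
  using (_≡_; _≢_; refl; sym; trans; cong; cong₂; module ≡-Reasoning)

-- Sums over lists and indicators

𝟙 : Bool → ℕ
𝟙 true  = 1
𝟙 false = 0

∑ : {A : Set} → List A → (A → ℕ) → ℕ
∑ []       f = 0
∑ (x ∷ xs) f = f x + ∑ xs f

infix 5 ∑
syntax ∑ xs (λ x → e) = ∑[ x ∈ xs ] e

module _ {A : Set} where

  ∑-cong : (xs : List A) {f g : A → ℕ} → (∀ x → f x ≡ g x) → ∑ xs f ≡ ∑ xs g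
  ∑-cong []       f≗g = refl
  ∑-cong (x ∷ xs) f≗g = cong₂ _+_ (f≗g x) (∑-cong xs f≗g)

  ∑-zero : (xs : List A) → ∑[ _ ∈ xs ] 0 ≡ 0
  ∑-zero []       = refl
  ∑-zero (x ∷ xs) = ∑-zero xs

  ∑-distrib-+ : (xs : List A) (f g : A → ℕ) → ∑[ x ∈ xs ] (f x + g x) ≡ ∑ xs f + ∑ xs g
  ∑-distrib-+ []       f g = refl
  ∑-distrib-+ (x ∷ xs) f g = begin
    f x + g x + (∑[ x ∈ xs ] (f x + g x)) ≡⟨ cong (f x + g x +_) (∑-distrib-+ xs f g) ⟩
    f x + g x + (∑ xs f + ∑ xs g)         ≡⟨ +-interchange (f x) (g x) (∑ xs f) (∑ xs g) ⟩
    f x + ∑ xs f + (g x + ∑ xs g)         ∎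
    where open ≡-Reasoning

  ∑-*ˡ : (xs : List A) (c : ℕ) (f : A → ℕ) → ∑[ x ∈ xs ] c * f x ≡ c * ∑ xs f
  ∑-*ˡ []       c f = sym (*-zeroʳ c)
  ∑-*ˡ (x ∷ xs) c f = trans (cong (c * f x +_) (∑-*ˡ xs c f)) (sym (*-distribˡ-+ c (f x) (∑ xs f)))

  ∑-*ʳ : (xs : List A) (c : ℕ) (f : A → ℕ) → ∑[ x ∈ xs ] f x * c ≡ ∑ xs f * c
  ∑-*ʳ xs c f = trans (∑-cong xs (λ x → *-comm (f x) c)) (trans (∑-*ˡ xs c f) (*-comm c (∑ xs f)))

  ∑-++ : (xs ys : List A) (f : A → ℕ) → ∑ (xs ++ ys) f ≡ ∑ xs f + ∑ ys f
  ∑-++ []       ys f = refl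
  ∑-++ (x ∷ xs) ys f = trans (cong (f x +_) (∑-++ xs ys f)) (sym (+-assoc (f x) _ _))

  ∑-filter : ∀ {ℓ} {P : Pred A ℓ} (P? : Decidable P) (xs : List A) (f : A → ℕ) →
             ∑ (filter P? xs) f ≡ ∑[ x ∈ xs ] 𝟙 (does (P? x)) * f x
  ∑-filter P? []       f = refl
  ∑-filter P? (x ∷ xs) f with does (P? x)
  ... | true  = cong₂ _+_ (sym (+-identityʳ (f x))) (∑-filter P? xs f)
  ... | false = ∑-filter P? xs f

  length≡∑1 : (xs : List A) → length xs ≡ ∑[ _ ∈ xs ] 1
  length≡∑1 []       = refl
  length≡∑1 (x ∷ xs) = cong suc (length≡∑1 xs)

∑-comm : {A B : Set} (xs : List A) (ys : List B) (f : A → B → ℕ) →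
         ∑[ x ∈ xs ] ∑[ y ∈ ys ] f x y ≡ ∑[ y ∈ ys ] ∑[ x ∈ xs ] f x y
∑-comm []       ys f = sym (∑-zero ys)
∑-comm (x ∷ xs) ys f = trans (cong (∑ ys (f x) +_) (∑-comm xs ys f))
                             (sym (∑-distrib-+ ys (f x) (λ y → ∑[ x ∈ xs ] f x y)))

∑-map : {A B : Set} (h : A → B) (xs : List A) (f : B → ℕ) → ∑ (map h xs) f ≡ ∑ xs (f ∘ h)
∑-map h []       f = refl
∑-map h (x ∷ xs) f = cong (f (h x) +_) (∑-map h xs f)

∑-concatMap : {A B : Set} (g : A → List B) (xs : List A) (f : B → ℕ) →
              ∑ (concatMap g xs) f ≡ ∑[ x ∈ xs ] ∑ (g x) f
∑-concatMap g []       f = refl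
∑-concatMap g (x ∷ xs) f = trans (∑-++ (g x) (concatMap g xs) f) (cong (∑ (g x) f +_) (∑-concatMap g xs f))

∑-allFin-suc : ∀ n (h : Fin (suc n) → ℕ) → ∑ (allFin (suc n)) h ≡ h zero + ∑ (allFin n) (h ∘ suc)
∑-allFin-suc n h = cong (h zero +_) (trans (cong (λ l → ∑ l h) (sym (map-tabulate id suc))) (∑-map suc (allFin n) h))

𝟙-∧ : ∀ a b → 𝟙 (a ∧ b) ≡ 𝟙 a * 𝟙 b
𝟙-∧ true  b = sym (+-identityʳ (𝟙 b))
𝟙-∧ false b = refl

δℕ : ℕ → ℕ → ℕ
δℕ a k = 𝟙 (does (a ≟ℕ k))

δℕ-< : ∀ {a k} → a < k → δℕ a k ≡ 0
δℕ-< {a} {k} a<k = cong 𝟙 (dec-false (a ≟ℕ k) (λ { refl → n≮n a a<k }))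

IsBit : ℕ → Set
IsBit c = c ≡ 0 ⊎ c ≡ 1

𝟙-isBit : ∀ b → IsBit (𝟙 b)
𝟙-isBit true  = inj₂ refl
𝟙-isBit false = inj₁ refl

*-isBit : ∀ {a b} → IsBit a → IsBit b → IsBit (a * b)
*-isBit (inj₁ refl) _ = inj₁ refl
*-isBit {b = b} (inj₂ refl) b-bit rewrite +-identityʳ b = b-bit

isBit-*-cong : ∀ {c} → IsBit c → ∀ {a b} → (c ≡ 1 → a ≡ b) → c * a ≡ c * b
isBit-*-cong (inj₁ refl) a≡b = refl
isBit-*-cong (inj₂ refl) a≡b = cong (_+ 0) (a≡b refl)

module _ {n : ℕ} where

  _≢ᵇ_ : Fin n → Fin n → Bool
  x ≢ᵇ y = not (does (x ≟ y))

  δ δᶜ : Fin n → Fin n → ℕ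
  δ  x y = 𝟙 (does (x ≟ y))
  δᶜ x y = 𝟙 (x ≢ᵇ y)

  δ-≡ : {x y : Fin n} → x ≡ y → δ x y ≡ 1
  δ-≡ {x} {y} x≡y with x ≟ y
  ... | yes _   = refl
  ... | no x≢y  = ⊥-elim (x≢y x≡y)

  δ-≢ : {x y : Fin n} → x ≢ y → δ x y ≡ 0
  δ-≢ {x} {y} x≢y with x ≟ y
  ... | yes x≡y = ⊥-elim (x≢y x≡y)
  ... | no _    = refl

  δᶜ-≡ : {x y : Fin n} → x ≡ y → δᶜ x y ≡ 0
  δᶜ-≡ {x} {y} x≡y with x ≟ y
  ... | yes _   = refl
  ... | no x≢y  = ⊥-elim (x≢y x≡y)

  δᶜ-≢ : {x y : Fin n} → x ≢ y → δᶜ x y ≡ 1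
  δᶜ-≢ {x} {y} x≢y with x ≟ y
  ... | yes x≡y = ⊥-elim (x≢y x≡y)
  ... | no _    = refl

  δᶜ≡1⇒≢ : {x y : Fin n} → δᶜ x y ≡ 1 → x ≢ y
  δᶜ≡1⇒≢ {x} {y} δᶜ≡1 x≡y with x ≟ y
  δᶜ≡1⇒≢ () _ | yes _
  ... | no x≢y = x≢y x≡y

  δ-refl : (x : Fin n) → δ x x ≡ 1
  δ-refl x = δ-≡ {x} refl

  δᶜ-refl : (x : Fin n) → δᶜ x x ≡ 0
  δᶜ-refl x = δᶜ-≡ {x} refl

  δ-sym : (x y : Fin n) → δ x y ≡ δ y x
  δ-sym x y with x ≟ y
  ... | yes x≡y = sym (δ-≡ (sym x≡y))
  ... | no x≢y  = sym (δ-≢ (x≢y ∘ sym))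

  δᶜ-sym : (x y : Fin n) → δᶜ x y ≡ δᶜ y x
  δᶜ-sym x y with x ≟ y
  ... | yes x≡y = sym (δᶜ-≡ (sym x≡y))
  ... | no x≢y  = sym (δᶜ-≢ (x≢y ∘ sym))

  δ+δᶜ≡1 : (x y : Fin n) → δ x y + δᶜ x y ≡ 1
  δ+δᶜ≡1 x y with x ≟ y
  ... | yes _ = refl
  ... | no _  = refl

  δᶜ-isBit : (x y : Fin n) → IsBit (δᶜ x y)
  δᶜ-isBit x y = 𝟙-isBit (x ≢ᵇ y)

∑-δˡ : ∀ n (a : Fin n) (h : Fin n → ℕ) → ∑[ z ∈ allFin n ] δ a z * h z ≡ h a
∑-δˡ (suc n) zero    h = begin
  ∑[ z ∈ allFin (suc n) ] δ zero z * h z ≡⟨ ∑-allFin-suc n (λ z → δ zero z * h z) ⟩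
  h zero + 0 + (∑[ z ∈ allFin n ] 0)     ≡⟨ cong₂ _+_ (+-identityʳ (h zero)) (∑-zero (allFin n)) ⟩
  h zero + 0                             ≡⟨ +-identityʳ (h zero) ⟩
  h zero                                 ∎
  where open ≡-Reasoning
∑-δˡ (suc n) (suc a) h = trans (∑-allFin-suc n (λ z → δ (suc a) z * h z)) (∑-δˡ n a (h ∘ suc))

∑-δʳ : ∀ n (a : Fin n) (h : Fin n → ℕ) → ∑[ z ∈ allFin n ] δ z a * h z ≡ h a
∑-δʳ n a h = trans (∑-cong (allFin n) (λ z → cong (_* h z) (δ-sym z a))) (∑-δˡ n a h)

-- Lists over Fin n through their multiplicities

module _ {n : ℕ} where

  mult : List (Fin n) → Fin n → ℕ
  mult xs z = ∑[ y ∈ xs ] δ y z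

  remove : Fin n → List (Fin n) → List (Fin n)
  remove x = filterᵇ (x ≢ᵇ_)

  NoRepeats : List (Fin n) → Set
  NoRepeats xs = ∀ z → IsBit (mult xs z)

  ∑-via-mult : (xs : List (Fin n)) (h : Fin n → ℕ) → ∑ xs h ≡ ∑[ z ∈ allFin n ] mult xs z * h z
  ∑-via-mult []       h = sym (∑-zero (allFin n))
  ∑-via-mult (x ∷ xs) h = sym (begin
    ∑[ z ∈ allFin n ] (δ x z + mult xs z) * h z
      ≡⟨ ∑-cong (allFin n) (λ z → *-distribʳ-+ (h z) (δ x z) (mult xs z)) ⟩
    ∑[ z ∈ allFin n ] (δ x z * h z + mult xs z * h z)
      ≡⟨ ∑-distrib-+ (allFin n) _ _ ⟩
    (∑[ z ∈ allFin n ] δ x z * h z) + (∑[ z ∈ allFin n ] mult xs z * h z)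
      ≡⟨ cong₂ _+_ (∑-δˡ n x h) (sym (∑-via-mult xs h)) ⟩
    h x + ∑ xs h ∎)
    where open ≡-Reasoning

  length-via-mult : (xs : List (Fin n)) → length xs ≡ ∑ (allFin n) (mult xs)
  length-via-mult xs = trans (length≡∑1 xs)
    (trans (∑-via-mult xs (λ _ → 1)) (∑-cong (allFin n) (λ z → *-identityʳ (mult xs z))))

  mult-remove : (x : Fin n) (xs : List (Fin n)) (w : Fin n) → mult (remove x xs) w ≡ δᶜ x w * mult xs w
  mult-remove x xs w = trans (∑-filter _ xs _) (trans (∑-cong xs same-weight) (∑-*ˡ xs (δᶜ x w) (λ y → δ y w)))
    where
    same-weight : ∀ y → δᶜ x y * δ y w ≡ δᶜ x w * δ y w
    same-weight y with y ≟ w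
    ... | yes refl = refl
    ... | no _     = trans (*-zeroʳ (δᶜ x y)) (sym (*-zeroʳ (δᶜ x w)))

  length-remove : (x : Fin n) (xs : List (Fin n)) → length (remove x xs) ≡ ∑[ z ∈ allFin n ] δᶜ x z * mult xs z
  length-remove x xs = trans (length-via-mult (remove x xs)) (∑-cong (allFin n) (mult-remove x xs))

  length-remove+mult : (x : Fin n) (xs : List (Fin n)) → length (remove x xs) + mult xs x ≡ length xs
  length-remove+mult x xs = begin
    length (remove x xs) + mult xs x
      ≡⟨ cong (_+ mult xs x) (trans (length≡∑1 (remove x xs)) (∑-filter _ xs _)) ⟩
    (∑[ y ∈ xs ] δᶜ x y * 1) + (∑[ y ∈ xs ] δ y x)
      ≡⟨ sym (∑-distrib-+ xs _ _) ⟩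
    ∑[ y ∈ xs ] (δᶜ x y * 1 + δ y x)
      ≡⟨ ∑-cong xs (λ y → trans (cong₂ _+_ (*-identityʳ (δᶜ x y)) (δ-sym y x))
                                (trans (+-comm (δᶜ x y) (δ x y)) (δ+δᶜ≡1 x y))) ⟩
    ∑[ _ ∈ xs ] 1
      ≡⟨ sym (length≡∑1 xs) ⟩
    length xs ∎
    where open ≡-Reasoning

  length-remove-member : (x : Fin n) (xs : List (Fin n)) → mult xs x ≡ 1 → length (remove x xs) ≡ length xs ∸ 1
  length-remove-member x xs x∈xs = sym (begin
    length xs ∸ 1                        ≡⟨ cong (_∸ 1) (sym (length-remove+mult x xs)) ⟩
    length (remove x xs) + mult xs x ∸ 1 ≡⟨ cong (λ m → length (remove x xs) + m ∸ 1) x∈xs ⟩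
    length (remove x xs) + 1 ∸ 1         ≡⟨ m+n∸n≡m (length (remove x xs)) 1 ⟩
    length (remove x xs)                 ∎)
    where open ≡-Reasoning

  ∑-mult-δʳ : (xs : List (Fin n)) (x : Fin n) (h : Fin n → ℕ) →
              ∑[ z ∈ allFin n ] mult xs z * (δ z x * h z) ≡ mult xs x * h x
  ∑-mult-δʳ xs x h = trans (∑-cong (allFin n) (λ z → x*yz≡y*xz (mult xs z) (δ z x) (h z)))
                           (∑-δʳ n x (λ z → mult xs z * h z))

  NoRepeats-remove : (x : Fin n) (xs : List (Fin n)) → NoRepeats xs → NoRepeats (remove x xs)
  NoRepeats-remove x xs noRep z rewrite mult-remove x xs z with δᶜ-isBit x z
  ... | inj₁ δᶜ≡0 rewrite δᶜ≡0 = inj₁ refl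
  ... | inj₂ δᶜ≡1 rewrite δᶜ≡1 | +-identityʳ (mult xs z) = noRep z

  ∑-remove : (xs : List (Fin n)) → NoRepeats xs → (F : ℕ → Fin n → ℕ) →
             ∑[ x ∈ xs ] F (length (remove x xs)) x ≡ ∑[ z ∈ allFin n ] mult xs z * F (length xs ∸ 1) z
  ∑-remove xs noRep F = trans (∑-via-mult xs _) (∑-cong (allFin n) (λ z →
    isBit-*-cong (noRep z) (λ z∈xs → cong (λ ℓ → F ℓ z) (length-remove-member z xs z∈xs))))

-- Counting vectors with distinct entries

∑-vecsOver-suc : {A : Set} (xs : List A) (m : ℕ) (f : Vec A (suc m) → ℕ) →
                 ∑ (vecsOver xs (suc m)) f ≡ ∑[ x ∈ xs ] ∑[ v ∈ vecsOver xs m ] f (x ∷ v)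
∑-vecsOver-suc xs m f = trans (∑-concatMap _ xs f) (∑-cong xs (λ x → ∑-map (x ∷_) (vecsOver xs m) f))

allᵇ : {A : Set} {m : ℕ} → (A → Bool) → Vec A m → Bool
allᵇ p []      = true
allᵇ p (x ∷ v) = p x ∧ allᵇ p v

∑-vecsOver-allᵇ : {A : Set} (p : A → Bool) (xs : List A) (m : ℕ) (R : Vec A m → ℕ) →
                  ∑[ v ∈ vecsOver xs m ] 𝟙 (allᵇ p v) * R v ≡ ∑ (vecsOver (filterᵇ p xs) m) R
∑-vecsOver-allᵇ p xs zero    R = cong (_+ 0) (*-identityˡ (R []))
∑-vecsOver-allᵇ p xs (suc m) R = begin
  ∑[ v ∈ vecsOver xs (suc m) ] 𝟙 (allᵇ p v) * R v
    ≡⟨ ∑-vecsOver-suc xs m _ ⟩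
  ∑[ x ∈ xs ] ∑[ v ∈ vecsOver xs m ] 𝟙 (p x ∧ allᵇ p v) * R (x ∷ v)
    ≡⟨ ∑-cong xs (λ x → ∑-cong (vecsOver xs m) (λ v →
         trans (cong (_* R (x ∷ v)) (𝟙-∧ (p x) (allᵇ p v))) (*-assoc (𝟙 (p x)) _ _))) ⟩
  ∑[ x ∈ xs ] ∑[ v ∈ vecsOver xs m ] 𝟙 (p x) * (𝟙 (allᵇ p v) * R (x ∷ v))
    ≡⟨ ∑-cong xs (λ x → ∑-*ˡ (vecsOver xs m) (𝟙 (p x)) _) ⟩
  ∑[ x ∈ xs ] 𝟙 (p x) * (∑[ v ∈ vecsOver xs m ] 𝟙 (allᵇ p v) * R (x ∷ v))
    ≡⟨ ∑-cong xs (λ x → cong (𝟙 (p x) *_) (∑-vecsOver-allᵇ p xs m (R ∘ (x ∷_)))) ⟩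
  ∑[ x ∈ xs ] 𝟙 (p x) * ∑ (vecsOver (filterᵇ p xs) m) (R ∘ (x ∷_))
    ≡⟨ sym (∑-filter _ xs _) ⟩
  ∑[ x ∈ filterᵇ p xs ] ∑ (vecsOver (filterᵇ p xs) m) (R ∘ (x ∷_))
    ≡⟨ sym (∑-vecsOver-suc (filterᵇ p xs) m R) ⟩
  ∑ (vecsOver (filterᵇ p xs) (suc m)) R ∎
  where open ≡-Reasoning

distinctᵇ : {n m : ℕ} → Vec (Fin n) m → Bool
distinctᵇ []      = true
distinctᵇ (x ∷ v) = allᵇ (x ≢ᵇ_) v ∧ distinctᵇ v

∑-distinct-cons : {n : ℕ} (xs : List (Fin n)) (m : ℕ) (f : Vec (Fin n) (suc m) → ℕ) →
  ∑[ v ∈ vecsOver xs (suc m) ] 𝟙 (distinctᵇ v) * f v ≡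
  ∑[ x ∈ xs ] ∑[ v ∈ vecsOver (remove x xs) m ] 𝟙 (distinctᵇ v) * f (x ∷ v)
∑-distinct-cons xs m f = trans (∑-vecsOver-suc xs m _) (∑-cong xs (λ x →
  trans (∑-cong (vecsOver xs m) (λ v → trans (cong (_* f (x ∷ v)) (𝟙-∧ (allᵇ (x ≢ᵇ_) v) (distinctᵇ v)))
                                            (*-assoc (𝟙 (allᵇ (x ≢ᵇ_) v)) (𝟙 (distinctᵇ v)) (f (x ∷ v)))))
        (∑-vecsOver-allᵇ (x ≢ᵇ_) xs m _)))

fallingFactorial : ℕ → ℕ → ℕ
fallingFactorial ℓ zero    = 1
fallingFactorial ℓ (suc m) = ℓ * fallingFactorial (ℓ ∸ 1) m

fallingFactorial-! : ∀ m → fallingFactorial m m ≡ m !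
fallingFactorial-! zero    = refl
fallingFactorial-! (suc m) = cong (suc m *_) (fallingFactorial-! m)

module _ {n : ℕ} where

  ∑-distinct : (m : ℕ) (xs : List (Fin n)) → NoRepeats xs →
               ∑[ v ∈ vecsOver xs m ] 𝟙 (distinctᵇ v) * 1 ≡ fallingFactorial (length xs) m
  ∑-distinct zero    xs noRep = refl
  ∑-distinct (suc m) xs noRep = begin
    ∑[ v ∈ vecsOver xs (suc m) ] 𝟙 (distinctᵇ v) * 1
      ≡⟨ ∑-distinct-cons xs m _ ⟩
    ∑[ x ∈ xs ] ∑[ v ∈ vecsOver (remove x xs) m ] 𝟙 (distinctᵇ v) * 1
      ≡⟨ ∑-cong xs (λ x → ∑-distinct m (remove x xs) (NoRepeats-remove x xs noRep)) ⟩
    ∑[ x ∈ xs ] fallingFactorial (length (remove x xs)) m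
      ≡⟨ ∑-remove xs noRep (λ ℓ _ → fallingFactorial ℓ m) ⟩
    ∑[ z ∈ allFin n ] mult xs z * fallingFactorial (length xs ∸ 1) m
      ≡⟨ ∑-*ʳ (allFin n) _ (mult xs) ⟩
    ∑ (allFin n) (mult xs) * fallingFactorial (length xs ∸ 1) m
      ≡⟨ cong (_* fallingFactorial (length xs ∸ 1) m) (sym (length-via-mult xs)) ⟩
    fallingFactorial (length xs) (suc m) ∎
    where open ≡-Reasoning

  ∑-distinct-at : (m : ℕ) (xs : List (Fin n)) → NoRepeats xs → (i : Fin (suc m)) (x : Fin n) →
                  ∑[ v ∈ vecsOver xs (suc m) ] 𝟙 (distinctᵇ v) * δ (lookup v i) x
                  ≡ mult xs x * fallingFactorial (length xs ∸ 1) m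
  ∑-distinct-at m xs noRep zero x = begin
    ∑[ v ∈ vecsOver xs (suc m) ] 𝟙 (distinctᵇ v) * δ (lookup v zero) x
      ≡⟨ ∑-distinct-cons xs m _ ⟩
    ∑[ y ∈ xs ] ∑[ v ∈ vecsOver (remove y xs) m ] 𝟙 (distinctᵇ v) * δ y x
      ≡⟨ ∑-cong xs (λ y → trans (∑-cong (vecsOver (remove y xs) m) (λ v → pull (𝟙 (distinctᵇ v)) (δ y x)))
                                (∑-*ˡ (vecsOver (remove y xs) m) (δ y x) _)) ⟩
    ∑[ y ∈ xs ] δ y x * (∑[ v ∈ vecsOver (remove y xs) m ] 𝟙 (distinctᵇ v) * 1)
      ≡⟨ ∑-cong xs (λ y → cong (δ y x *_) (∑-distinct m (remove y xs) (NoRepeats-remove y xs noRep))) ⟩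
    ∑[ y ∈ xs ] δ y x * fallingFactorial (length (remove y xs)) m
      ≡⟨ ∑-remove xs noRep (λ ℓ y → δ y x * fallingFactorial ℓ m) ⟩
    ∑[ z ∈ allFin n ] mult xs z * (δ z x * fallingFactorial (length xs ∸ 1) m)
      ≡⟨ ∑-mult-δʳ xs x _ ⟩
    mult xs x * fallingFactorial (length xs ∸ 1) m ∎
    where
    open ≡-Reasoning
    pull : ∀ a b → a * b ≡ b * (a * 1)
    pull = solve-∀
  ∑-distinct-at (suc m) xs noRep (suc i) x = begin
    ∑[ v ∈ vecsOver xs (suc (suc m)) ] 𝟙 (distinctᵇ v) * δ (lookup v (suc i)) x
      ≡⟨ ∑-distinct-cons xs (suc m) _ ⟩
    ∑[ y ∈ xs ] ∑[ v ∈ vecsOver (remove y xs) (suc m) ] 𝟙 (distinctᵇ v) * δ (lookup v i) x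
      ≡⟨ ∑-cong xs (λ y → ∑-distinct-at m (remove y xs) (NoRepeats-remove y xs noRep) i x) ⟩
    ∑[ y ∈ xs ] mult (remove y xs) x * fallingFactorial (length (remove y xs) ∸ 1) m
      ≡⟨ ∑-remove xs noRep (λ ℓ y → mult (remove y xs) x * fallingFactorial (ℓ ∸ 1) m) ⟩
    ∑[ z ∈ allFin n ] mult xs z * (mult (remove z xs) x * F)
      ≡⟨ ∑-cong (allFin n) (λ z → trans (cong (λ t → mult xs z * (t * F)) (mult-remove z xs x))
                                        (trans (shuffle (mult xs z) (δᶜ z x) (mult xs x) F)
                                               (cong (λ t → t * mult xs z * (mult xs x * F)) (δᶜ-sym z x)))) ⟩
    ∑[ z ∈ allFin n ] δᶜ x z * mult xs z * (mult xs x * F)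
      ≡⟨ ∑-*ʳ (allFin n) _ (λ z → δᶜ x z * mult xs z) ⟩
    (∑[ z ∈ allFin n ] δᶜ x z * mult xs z) * (mult xs x * F)
      ≡⟨ cong (_* (mult xs x * F)) (sym (length-remove x xs)) ⟩
    length (remove x xs) * (mult xs x * F)
      ≡⟨ x*yz≡y*xz (length (remove x xs)) (mult xs x) F ⟩
    mult xs x * (length (remove x xs) * F)
      ≡⟨ isBit-*-cong (noRep x) (λ x∈xs → cong (_* F) (length-remove-member x xs x∈xs)) ⟩
    mult xs x * fallingFactorial (length xs ∸ 1) (suc m) ∎
    where
    open ≡-Reasoning
    F : ℕ
    F = fallingFactorial (length xs ∸ 1 ∸ 1) m
    shuffle : ∀ a b c d → a * (b * c * d) ≡ b * a * (c * d)
    shuffle = solve-∀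

  ∑-distinct-at₂ : (m : ℕ) (xs : List (Fin n)) → NoRepeats xs →
                   (i j : Fin (suc (suc m))) → i ≢ j → (x y : Fin n) →
                   ∑[ v ∈ vecsOver xs (suc (suc m)) ] 𝟙 (distinctᵇ v) * (δ (lookup v i) x * δ (lookup v j) y)
                   ≡ mult xs x * mult xs y * δᶜ x y * fallingFactorial (length xs ∸ 1 ∸ 1) m
  ∑-distinct-at₂ m xs noRep zero zero i≢j x y = ⊥-elim (i≢j refl)
  ∑-distinct-at₂ m xs noRep zero (suc j) _ x y = begin
    ∑[ v ∈ vecsOver xs (suc (suc m)) ] 𝟙 (distinctᵇ v) * (δ (lookup v zero) x * δ (lookup v (suc j)) y)
      ≡⟨ ∑-distinct-cons xs (suc m) _ ⟩
    ∑[ w ∈ xs ] ∑[ v ∈ vecsOver (remove w xs) (suc m) ] 𝟙 (distinctᵇ v) * (δ w x * δ (lookup v j) y)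
      ≡⟨ ∑-cong xs (λ w → trans (∑-cong (vecsOver (remove w xs) (suc m))
                                        (λ v → x*yz≡y*xz (𝟙 (distinctᵇ v)) (δ w x) _))
                                (∑-*ˡ (vecsOver (remove w xs) (suc m)) (δ w x) _)) ⟩
    ∑[ w ∈ xs ] δ w x * (∑[ v ∈ vecsOver (remove w xs) (suc m) ] 𝟙 (distinctᵇ v) * δ (lookup v j) y)
      ≡⟨ ∑-cong xs (λ w → cong (δ w x *_) (∑-distinct-at m (remove w xs) (NoRepeats-remove w xs noRep) j y)) ⟩
    ∑[ w ∈ xs ] δ w x * (mult (remove w xs) y * fallingFactorial (length (remove w xs) ∸ 1) m)
      ≡⟨ ∑-remove xs noRep (λ ℓ w → δ w x * (mult (remove w xs) y * fallingFactorial (ℓ ∸ 1) m)) ⟩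
    ∑[ z ∈ allFin n ] mult xs z * (δ z x * (mult (remove z xs) y * F))
      ≡⟨ ∑-mult-δʳ xs x _ ⟩
    mult xs x * (mult (remove x xs) y * F)
      ≡⟨ cong (λ t → mult xs x * (t * F)) (mult-remove x xs y) ⟩
    mult xs x * (δᶜ x y * mult xs y * F)
      ≡⟨ shuffle (mult xs x) (δᶜ x y) (mult xs y) F ⟩
    mult xs x * mult xs y * δᶜ x y * F ∎
    where
    open ≡-Reasoning
    F : ℕ
    F = fallingFactorial (length xs ∸ 1 ∸ 1) m
    shuffle : ∀ a b c d → a * (b * c * d) ≡ a * c * b * d
    shuffle = solve-∀
  ∑-distinct-at₂ m xs noRep (suc i) zero _ x y = begin
    ∑[ v ∈ vecsOver xs (suc (suc m)) ] 𝟙 (distinctᵇ v) * (δ (lookup v (suc i)) x * δ (lookup v zero) y)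
      ≡⟨ ∑-cong (vecsOver xs (suc (suc m))) (λ v → cong (𝟙 (distinctᵇ v) *_) (*-comm (δ (lookup v (suc i)) x) _)) ⟩
    ∑[ v ∈ vecsOver xs (suc (suc m)) ] 𝟙 (distinctᵇ v) * (δ (lookup v zero) y * δ (lookup v (suc i)) x)
      ≡⟨ ∑-distinct-at₂ m xs noRep zero (suc i) (λ ()) y x ⟩
    mult xs y * mult xs x * δᶜ y x * F
      ≡⟨ cong₂ (λ a b → a * b * F) (*-comm (mult xs y) (mult xs x)) (δᶜ-sym y x) ⟩
    mult xs x * mult xs y * δᶜ x y * F ∎
    where
    open ≡-Reasoning
    F : ℕ
    F = fallingFactorial (length xs ∸ 1 ∸ 1) m
  ∑-distinct-at₂ zero    xs noRep (suc zero) (suc zero) i≢j x y = ⊥-elim (i≢j refl)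
  ∑-distinct-at₂ (suc m) xs noRep (suc i) (suc j) i≢j x y = begin
    ∑[ v ∈ vecsOver xs (suc (suc (suc m))) ] 𝟙 (distinctᵇ v) * (δ (lookup v (suc i)) x * δ (lookup v (suc j)) y)
      ≡⟨ ∑-distinct-cons xs (suc (suc m)) _ ⟩
    ∑[ w ∈ xs ] ∑[ v ∈ vecsOver (remove w xs) (suc (suc m)) ] 𝟙 (distinctᵇ v) * (δ (lookup v i) x * δ (lookup v j) y)
      ≡⟨ ∑-cong xs (λ w → ∑-distinct-at₂ m (remove w xs) (NoRepeats-remove w xs noRep) i j (i≢j ∘ cong suc) x y) ⟩
    ∑[ w ∈ xs ] mult (remove w xs) x * mult (remove w xs) y * δᶜ x y * fallingFactorial (length (remove w xs) ∸ 1 ∸ 1) m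
      ≡⟨ ∑-remove xs noRep (λ ℓ w → mult (remove w xs) x * mult (remove w xs) y * δᶜ x y
                                    * fallingFactorial (ℓ ∸ 1 ∸ 1) m) ⟩
    ∑[ z ∈ allFin n ] mult xs z * (mult (remove z xs) x * mult (remove z xs) y * δᶜ x y * F)
      ≡⟨ ∑-cong (allFin n) factor ⟩
    ∑[ z ∈ allFin n ] δᶜ y z * (δᶜ x z * mult xs z) * (P * F)
      ≡⟨ ∑-*ʳ (allFin n) (P * F) (λ z → δᶜ y z * (δᶜ x z * mult xs z)) ⟩
    (∑[ z ∈ allFin n ] δᶜ y z * (δᶜ x z * mult xs z)) * (P * F)
      ≡⟨ cong (_* (P * F)) (sym length-remove₂) ⟩
    length (remove y (remove x xs)) * (P * F)
      ≡⟨ x*yz≡y*xz (length (remove y (remove x xs))) P F ⟩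
    P * (length (remove y (remove x xs)) * F)
      ≡⟨ isBit-*-cong P-isBit (λ P≡1 → cong (_* F) (length-remove₂-members P≡1)) ⟩
    P * fallingFactorial (length xs ∸ 1 ∸ 1) (suc m) ∎
    where
    open ≡-Reasoning
    F P : ℕ
    F = fallingFactorial (length xs ∸ 1 ∸ 1 ∸ 1) m
    P = mult xs x * mult xs y * δᶜ x y

    shuffle : ∀ a b c d e f g → a * (b * c * (d * e) * f * g) ≡ d * (b * a) * (c * e * f * g)
    shuffle = solve-∀

    factor : ∀ z → mult xs z * (mult (remove z xs) x * mult (remove z xs) y * δᶜ x y * F)
                   ≡ δᶜ y z * (δᶜ x z * mult xs z) * (P * F)
    factor z = begin
      mult xs z * (mult (remove z xs) x * mult (remove z xs) y * δᶜ x y * F)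
        ≡⟨ cong₂ (λ a b → mult xs z * (a * b * δᶜ x y * F)) (mult-remove z xs x) (mult-remove z xs y) ⟩
      mult xs z * (δᶜ z x * mult xs x * (δᶜ z y * mult xs y) * δᶜ x y * F)
        ≡⟨ shuffle (mult xs z) (δᶜ z x) (mult xs x) (δᶜ z y) (mult xs y) (δᶜ x y) F ⟩
      δᶜ z y * (δᶜ z x * mult xs z) * (P * F)
        ≡⟨ cong₂ (λ a b → a * (b * mult xs z) * (P * F)) (δᶜ-sym z y) (δᶜ-sym z x) ⟩
      δᶜ y z * (δᶜ x z * mult xs z) * (P * F) ∎

    length-remove₂ : length (remove y (remove x xs)) ≡ ∑[ z ∈ allFin n ] δᶜ y z * (δᶜ x z * mult xs z)
    length-remove₂ = trans (length-remove y (remove x xs)) (∑-cong (allFin n) (λ z → cong (δᶜ y z *_) (mult-remove x xs z)))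

    P-isBit : IsBit P
    P-isBit = *-isBit (*-isBit (noRep x) (noRep y)) (δᶜ-isBit x y)

    length-remove₂-members : P ≡ 1 → length (remove y (remove x xs)) ≡ length xs ∸ 1 ∸ 1
    length-remove₂-members P≡1 = trans (length-remove-member y (remove x xs) y∈xs∖x)
                                       (cong (_∸ 1) (length-remove-member x xs x∈xs))
      where
      x∈xs×y∈xs : mult xs x * mult xs y ≡ 1
      x∈xs×y∈xs = m*n≡1⇒m≡1 (mult xs x * mult xs y) (δᶜ x y) P≡1
      x∈xs : mult xs x ≡ 1
      x∈xs = m*n≡1⇒m≡1 (mult xs x) (mult xs y) x∈xs×y∈xs
      y∈xs : mult xs y ≡ 1
      y∈xs = m*n≡1⇒n≡1 (mult xs x) (mult xs y) x∈xs×y∈xs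
      y∈xs∖x : mult (remove x xs) y ≡ 1
      y∈xs∖x = trans (mult-remove x xs y)
                     (cong₂ _*_ (m*n≡1⇒n≡1 (mult xs x * mult xs y) (δᶜ x y) P≡1) y∈xs)

mult-allFin : ∀ n (x : Fin n) → mult (allFin n) x ≡ 1
mult-allFin n x = trans (∑-cong (allFin n) (λ y → sym (*-identityʳ (δ y x)))) (∑-δʳ n x (λ _ → 1))

NoRepeats-allFin : ∀ n → NoRepeats (allFin n)
NoRepeats-allFin n z = inj₂ (mult-allFin n z)

∑-perm-two-values : ∀ m (i j : Fin (suc (suc m))) → i ≢ j → (F : Fin (suc (suc m)) → Fin (suc (suc m)) → ℕ) →
  ∑[ v ∈ vecsOver (allFin (suc (suc m))) (suc (suc m)) ] 𝟙 (distinctᵇ v) * F (lookup v i) (lookup v j)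
  ≡ (∑[ x ∈ allFin (suc (suc m)) ] ∑[ y ∈ allFin (suc (suc m)) ] δᶜ x y * F x y) * m !
∑-perm-two-values m i j i≢j F = begin
  ∑[ v ∈ Vs ] 𝟙 (distinctᵇ v) * F (lookup v i) (lookup v j)
    ≡⟨ ∑-cong Vs (λ v → cong (𝟙 (distinctᵇ v) *_) (sym (expand (lookup v i) (lookup v j)))) ⟩
  ∑[ v ∈ Vs ] 𝟙 (distinctᵇ v) * (∑[ x ∈ Xs ] δ (lookup v i) x * (∑[ y ∈ Xs ] δ (lookup v j) y * F x y))
    ≡⟨ ∑-cong Vs (λ v → distribute (𝟙 (distinctᵇ v)) (δ (lookup v i)) (δ (lookup v j))) ⟩
  ∑[ v ∈ Vs ] ∑[ x ∈ Xs ] ∑[ y ∈ Xs ] F x y * (𝟙 (distinctᵇ v) * (δ (lookup v i) x * δ (lookup v j) y))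
    ≡⟨ ∑-comm Vs Xs _ ⟩
  ∑[ x ∈ Xs ] ∑[ v ∈ Vs ] ∑[ y ∈ Xs ] F x y * (𝟙 (distinctᵇ v) * (δ (lookup v i) x * δ (lookup v j) y))
    ≡⟨ ∑-cong Xs (λ x → ∑-comm Vs Xs _) ⟩
  ∑[ x ∈ Xs ] ∑[ y ∈ Xs ] ∑[ v ∈ Vs ] F x y * (𝟙 (distinctᵇ v) * (δ (lookup v i) x * δ (lookup v j) y))
    ≡⟨ ∑-cong Xs (λ x → ∑-cong Xs (λ y → trans (∑-*ˡ Vs (F x y) _) (cong (F x y *_) (count x y)))) ⟩
  ∑[ x ∈ Xs ] ∑[ y ∈ Xs ] F x y * (δᶜ x y * m !)
    ≡⟨ ∑-cong Xs (λ x → trans (∑-cong Xs (λ y → x*yz≡y*xz (F x y) (δᶜ x y) (m !)))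
                             (trans (∑-cong Xs (λ y → sym (*-assoc (δᶜ x y) (F x y) (m !))))
                                    (∑-*ʳ Xs (m !) (λ y → δᶜ x y * F x y)))) ⟩
  (∑[ x ∈ Xs ] (∑[ y ∈ Xs ] δᶜ x y * F x y) * m !)
    ≡⟨ ∑-*ʳ Xs (m !) (λ x → ∑[ y ∈ Xs ] δᶜ x y * F x y) ⟩
  (∑[ x ∈ Xs ] ∑[ y ∈ Xs ] δᶜ x y * F x y) * m ! ∎
  where
  open ≡-Reasoning
  N : ℕ
  N = suc (suc m)
  Xs : List (Fin N)
  Xs = allFin N
  Vs : List (Vec (Fin N) N)
  Vs = vecsOver Xs N

  expand : ∀ a b → ∑[ x ∈ Xs ] δ a x * (∑[ y ∈ Xs ] δ b y * F x y) ≡ F a b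
  expand a b = trans (∑-cong Xs (λ x → cong (δ a x *_) (∑-δˡ N b (F x)))) (∑-δˡ N a (λ x → F x b))

  distribute : ∀ u (f g : Fin N → ℕ) →
    u * (∑[ x ∈ Xs ] f x * (∑[ y ∈ Xs ] g y * F x y)) ≡ ∑[ x ∈ Xs ] ∑[ y ∈ Xs ] F x y * (u * (f x * g y))
  distribute u f g = trans (sym (∑-*ˡ Xs u _)) (∑-cong Xs (λ x →
    trans (cong (u *_) (sym (∑-*ˡ Xs (f x) _))) (trans (sym (∑-*ˡ Xs u _))
      (∑-cong Xs (λ y → shuffle u (f x) (g y) (F x y))))))
    where
    shuffle : ∀ a b c d → a * (b * (c * d)) ≡ d * (a * (b * c))
    shuffle = solve-∀

  count : ∀ x y → ∑[ v ∈ Vs ] 𝟙 (distinctᵇ v) * (δ (lookup v i) x * δ (lookup v j) y) ≡ δᶜ x y * m !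
  count x y = begin
    ∑[ v ∈ Vs ] 𝟙 (distinctᵇ v) * (δ (lookup v i) x * δ (lookup v j) y)
      ≡⟨ ∑-distinct-at₂ m Xs (NoRepeats-allFin N) i j i≢j x y ⟩
    mult Xs x * mult Xs y * δᶜ x y * fallingFactorial (length Xs ∸ 1 ∸ 1) m
      ≡⟨ cong₂ (λ a b → a * δᶜ x y * fallingFactorial (b ∸ 1 ∸ 1) m)
               (cong₂ _*_ (mult-allFin N x) (mult-allFin N y)) (length-tabulate {n = N} id) ⟩
    1 * 1 * δᶜ x y * fallingFactorial m m
      ≡⟨ cong₂ _*_ (+-identityʳ (δᶜ x y)) (fallingFactorial-! m) ⟩
    δᶜ x y * m ! ∎

-- Permutations as vectors with distinct entries

injective⇒surjective : ∀ {n} (f : Fin n → Fin n) → Injective _≡_ _≡_ f → ∀ t → ∃ λ a → f a ≡ t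
injective⇒surjective {suc n} f f-inj t with any? (λ a → f a ≟ t)
... | yes hit = hit
... | no miss = ⊥-elim (1+n≰n (injective⇒≤ {f = squeeze} squeeze-inj))
  where
  squeeze : Fin (suc n) → Fin n
  squeeze a = punchOut {i = t} (λ t≡fa → miss (a , sym t≡fa))
  squeeze-inj : Injective _≡_ _≡_ squeeze
  squeeze-inj {a} {b} = f-inj ∘ punchOut-injective (λ t≡fa → miss (a , sym t≡fa)) (λ t≡fb → miss (b , sym t≡fb))

∑-δ-injective : ∀ n (f : Fin n → Fin n) → Injective _≡_ _≡_ f → ∀ t → ∑[ a ∈ allFin n ] δ (f a) t ≡ 1
∑-δ-injective n f f-inj t with injective⇒surjective f f-inj t
... | p , fp≡t = trans (∑-cong (allFin n) δ-f) (∑-δʳ n p (λ _ → 1))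
  where
  δ-f : ∀ a → δ (f a) t ≡ δ a p * 1
  δ-f a with a ≟ p
  ... | yes refl = δ-≡ fp≡t
  ... | no a≢p   = δ-≢ (a≢p ∘ f-inj ∘ (λ fa≡t → trans fa≡t (sym fp≡t)))

allᵇ-lookup : {A : Set} {m : ℕ} (p : A → Bool) (v : Vec A m) → allᵇ p v ≡ true → ∀ b → p (lookup v b) ≡ true
allᵇ-lookup p (x ∷ v) all-p zero    = ∧-conicalˡ (p x) (allᵇ p v) all-p
allᵇ-lookup p (x ∷ v) all-p (suc b) = allᵇ-lookup p v (∧-conicalʳ (p x) (allᵇ p v) all-p) b

distinctᵇ-head : ∀ {n m} (x : Fin n) (v : Vec (Fin n) m) → distinctᵇ (x ∷ v) ≡ true → ∀ b → x ≢ lookup v b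
distinctᵇ-head x v dist b =
  δᶜ≡1⇒≢ (cong 𝟙 (allᵇ-lookup (x ≢ᵇ_) v (∧-conicalˡ (allᵇ (x ≢ᵇ_) v) (distinctᵇ v) dist) b))

distinctᵇ⇒lookup-injective : ∀ {n m} (v : Vec (Fin n) m) → distinctᵇ v ≡ true → Injective _≡_ _≡_ (lookup v)
distinctᵇ⇒lookup-injective (x ∷ v) dist {zero}  {zero}  _  = refl
distinctᵇ⇒lookup-injective (x ∷ v) dist {zero}  {suc b} eq = ⊥-elim (distinctᵇ-head x v dist b eq)
distinctᵇ⇒lookup-injective (x ∷ v) dist {suc a} {zero}  eq = ⊥-elim (distinctᵇ-head x v dist a (sym eq))
distinctᵇ⇒lookup-injective (x ∷ v) dist {suc a} {suc b} eq =
  cong suc (distinctᵇ⇒lookup-injective v (∧-conicalʳ (allᵇ (x ≢ᵇ_) v) (distinctᵇ v) dist) eq)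

does-unique?≡distinctᵇ : ∀ {n m} (v : Vec (Fin n) m) → does (UniqueDec.unique? _≟_ (toList v)) ≡ distinctᵇ v
does-unique?≡distinctᵇ []      = refl
does-unique?≡distinctᵇ (x ∷ v) = cong₂ _∧_ (does-all? v) (does-unique?≡distinctᵇ v)
  where
  does-all? : ∀ {m} (w : Vec _ m) → does (All.all? (λ y → ¬? (x ≟ y)) (toList w)) ≡ allᵇ (x ≢ᵇ_) w
  does-all? []      = refl
  does-all? (y ∷ w) = cong (x ≢ᵇ y ∧_) (does-all? w)

c-as-∑ : ∀ {n} (k : ℕ) (β : Fin n → Fin n) →
  c k β ≡ ∑[ v ∈ vecsOver (allFin n) n ] 𝟙 (distinctᵇ v) * δℕ (hamming (lookup v ∘ β) (β ∘ lookup v)) k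
c-as-∑ {n} k β = begin
  c k β
    ≡⟨ length≡∑1 (filter H? (filter U? Vs)) ⟩
  ∑[ _ ∈ filter H? (filter U? Vs) ] 1
    ≡⟨ ∑-filter H? (filter U? Vs) (λ _ → 1) ⟩
  ∑[ v ∈ filter U? Vs ] 𝟙 (does (H? v)) * 1
    ≡⟨ ∑-filter U? Vs _ ⟩
  ∑[ v ∈ Vs ] 𝟙 (does (U? v)) * (𝟙 (does (H? v)) * 1)
    ≡⟨ ∑-cong Vs (λ v → cong₂ _*_ (cong 𝟙 (does-unique?≡distinctᵇ v)) (*-identityʳ (𝟙 (does (H? v))))) ⟩
  ∑[ v ∈ Vs ] 𝟙 (distinctᵇ v) * 𝟙 (does (H? v)) ∎
  where
  open ≡-Reasoning
  Vs : List (Vec (Fin n) n)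
  Vs = vecsOver (allFin n) n
  U? : Decidable (λ (v : Vec (Fin n) n) → UniqueDec.Unique _≟_ (toList v))
  U? v = UniqueDec.unique? _≟_ (toList v)
  H? : Decidable (λ (v : Vec (Fin n) n) → hamming (lookup v ∘ β) (β ∘ lookup v) ≡ k)
  H? v = hamming (lookup v ∘ β) (β ∘ lookup v) ≟ℕ k

-- The transposition (i j)

module Transposition {n : ℕ} (i j : Fin n) (i≢j : i ≢ j) where

  β : Fin n → Fin n
  β = transpose i j

  β-i : β i ≡ j
  β-i rewrite dec-true (i ≟ i) refl = refl

  β-j : β j ≡ i
  β-j rewrite dec-false (j ≟ i) (i≢j ∘ sym) | dec-true (j ≟ j) refl = refl

  β-other : ∀ {a} → a ≢ i → a ≢ j → β a ≡ a
  β-other {a} a≢i a≢j rewrite dec-false (a ≟ i) a≢i | dec-false (a ≟ j) a≢j = refl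

  β-involutive : ∀ a → β (β a) ≡ a
  β-involutive a = by-cases (a ≟ i) (a ≟ j)
    where
    by-cases : Dec (a ≡ i) → Dec (a ≡ j) → β (β a) ≡ a
    by-cases (yes refl) _          = trans (cong β β-i) β-j
    by-cases (no _)     (yes refl) = trans (cong β β-j) β-i
    by-cases (no a≢i)   (no a≢j)   = trans (cong β (β-other a≢i a≢j)) (β-other a≢i a≢j)

  outside : Fin n → ℕ
  outside a = δᶜ a i * δᶜ a j

  outside-isBit : ∀ a → IsBit (outside a)
  outside-isBit a = *-isBit (δᶜ-isBit a i) (δᶜ-isBit a j)

  outside≡1⇒ : ∀ {a} → outside a ≡ 1 → a ≢ i × a ≢ j
  outside≡1⇒ {a} out = δᶜ≡1⇒≢ (m*n≡1⇒m≡1 (δᶜ a i) (δᶜ a j) out)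
                     , δᶜ≡1⇒≢ (m*n≡1⇒n≡1 (δᶜ a i) (δᶜ a j) out)

  δ+δ+outside≡1 : ∀ a → δ a i + δ a j + outside a ≡ 1
  δ+δ+outside≡1 a = by-cases (a ≟ i) (a ≟ j)
    where
    by-cases : Dec (a ≡ i) → Dec (a ≡ j) → δ a i + δ a j + outside a ≡ 1
    by-cases (yes refl) _          rewrite δ-refl i | δ-≢ i≢j | δᶜ-refl i = refl
    by-cases (no a≢i)   (yes refl) rewrite δ-≢ a≢i | δ-refl j | δᶜ-refl j | *-zeroʳ (δᶜ j i) = refl
    by-cases (no a≢i)   (no a≢j)   rewrite δ-≢ a≢i | δ-≢ a≢j | δᶜ-≢ a≢i | δᶜ-≢ a≢j = refl

  ∑-split : (h : Fin n → ℕ) → ∑ (allFin n) h ≡ h i + h j + (∑[ a ∈ allFin n ] outside a * h a)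
  ∑-split h = begin
    ∑ (allFin n) h
      ≡⟨ ∑-cong (allFin n) (λ a → sym (trans (cong (_* h a) (δ+δ+outside≡1 a)) (*-identityˡ (h a)))) ⟩
    ∑[ a ∈ allFin n ] (δ a i + δ a j + outside a) * h a
      ≡⟨ ∑-cong (allFin n) (λ a → distrib (δ a i) (δ a j) (outside a) (h a)) ⟩
    ∑[ a ∈ allFin n ] (δ a i * h a + δ a j * h a + outside a * h a)
      ≡⟨ ∑-distrib-+ (allFin n) _ _ ⟩
    (∑[ a ∈ allFin n ] (δ a i * h a + δ a j * h a)) + (∑[ a ∈ allFin n ] outside a * h a)
      ≡⟨ cong (_+ (∑[ a ∈ allFin n ] outside a * h a)) (∑-distrib-+ (allFin n) _ _) ⟩
    (∑[ a ∈ allFin n ] δ a i * h a) + (∑[ a ∈ allFin n ] δ a j * h a) + (∑[ a ∈ allFin n ] outside a * h a)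
      ≡⟨ cong (_+ (∑[ a ∈ allFin n ] outside a * h a)) (cong₂ _+_ (∑-δʳ n i h) (∑-δʳ n j h)) ⟩
    h i + h j + (∑[ a ∈ allFin n ] outside a * h a) ∎
    where
    open ≡-Reasoning
    distrib : ∀ a b c d → (a + b + c) * d ≡ a * d + b * d + c * d
    distrib = solve-∀

  ∑-outside-cong : (h h′ : Fin n → ℕ) → (∀ a → a ≢ i → a ≢ j → h a ≡ h′ a) →
                   ∑[ a ∈ allFin n ] outside a * h a ≡ ∑[ a ∈ allFin n ] outside a * h′ a
  ∑-outside-cong h h′ h≗h′ = ∑-cong (allFin n) (λ a →
    isBit-*-cong (outside-isBit a) (λ out → h≗h′ a (proj₁ (outside≡1⇒ out)) (proj₂ (outside≡1⇒ out))))

  ∑-outside : ∑ (allFin n) outside ≡ n ∸ 2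
  ∑-outside = sym (begin
    n ∸ 2
      ≡⟨ cong (_∸ 2) (trans (sym (length-tabulate {n = n} id)) (length≡∑1 (allFin n))) ⟩
    (∑[ _ ∈ allFin n ] 1) ∸ 2
      ≡⟨ cong (_∸ 2) (∑-split (λ _ → 1)) ⟩
    2 + (∑[ a ∈ allFin n ] outside a * 1) ∸ 2
      ≡⟨ m+n∸m≡n 2 _ ⟩
    ∑[ a ∈ allFin n ] outside a * 1
      ≡⟨ ∑-cong (allFin n) (λ a → *-identityʳ (outside a)) ⟩
    ∑ (allFin n) outside ∎)
    where open ≡-Reasoning

  ∑-outside-const : (h : Fin n → ℕ) (e : ℕ) → (∀ a → a ≢ i → a ≢ j → h a ≡ e) →
                    ∑[ a ∈ allFin n ] outside a * h a ≡ (n ∸ 2) * e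
  ∑-outside-const h e h≡e = trans (∑-outside-cong h (λ _ → e) h≡e)
                                  (trans (∑-*ʳ (allFin n) e outside) (cong (_* e) ∑-outside))

  δᶜ-β : ∀ b → δᶜ b (β b) ≡ δ b i + δ b j
  δᶜ-β b = by-cases (b ≟ i) (b ≟ j)
    where
    by-cases : Dec (b ≡ i) → Dec (b ≡ j) → δᶜ b (β b) ≡ δ b i + δ b j
    by-cases (yes refl) _          rewrite β-i | δᶜ-≢ i≢j | δ-refl i | δ-≢ i≢j = refl
    by-cases (no b≢i)   (yes refl) rewrite β-j | δᶜ-≢ (i≢j ∘ sym) | δ-refl j | δ-≢ b≢i = refl
    by-cases (no b≢i)   (no b≢j)   rewrite β-other b≢i b≢j | δᶜ-refl b | δ-≢ b≢i | δ-≢ b≢j = refl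

  δᶜ-β-swap : ∀ x y → δᶜ x (β y) ≡ δᶜ y (β x)
  δᶜ-β-swap x y with x ≟ β y | y ≟ β x
  ... | yes _    | yes _    = refl
  ... | no _     | no _     = refl
  ... | yes x≡βy | no y≢βx  = ⊥-elim (y≢βx (trans (sym (β-involutive y)) (cong β (sym x≡βy))))
  ... | no x≢βy  | yes y≡βx = ⊥-elim (x≢βy (trans (sym (β-involutive x)) (cong β (sym y≡βx))))

  -- H(αβ, βα) for α with α i = x and α j = y: a position a ∉ {i, j} is a disagreement iff
  -- α a ∈ {i, j}, and since α is a bijection this happens once for each of i, j that is not
  -- already among x, y; the positions i and j are both disagreements iff y ≠ β x.
  commutatorHamming : Fin n → Fin n → ℕ
  commutatorHamming x y = (1 ∸ (δ x i + δ y i)) + (1 ∸ (δ x j + δ y j)) + 2 * δᶜ y (β x)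

  hamming-commutator : (α : Fin n → Fin n) → Injective _≡_ _≡_ α →
                       hamming (α ∘ β) (β ∘ α) ≡ commutatorHamming (α i) (α j)
  hamming-commutator α α-inj = begin
    hamming (α ∘ β) (β ∘ α)
      ≡⟨ trans (length≡∑1 (filter disagree? (allFin n))) (∑-filter disagree? (allFin n) (λ _ → 1)) ⟩
    ∑[ a ∈ allFin n ] disagree a * 1
      ≡⟨ ∑-cong (allFin n) (λ a → *-identityʳ (disagree a)) ⟩
    ∑ (allFin n) disagree
      ≡⟨ ∑-split disagree ⟩
    disagree i + disagree j + (∑[ a ∈ allFin n ] outside a * disagree a)
      ≡⟨ cong₂ (λ s t → s + t + (∑[ a ∈ allFin n ] outside a * disagree a))
               (cong (λ b → δᶜ (α b) (β (α i))) β-i)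
               (trans (cong (λ b → δᶜ (α b) (β (α j))) β-j) (δᶜ-β-swap (α i) (α j))) ⟩
    X + X + (∑[ a ∈ allFin n ] outside a * disagree a)
      ≡⟨ cong (X + X +_) (∑-outside-cong disagree (λ a → δ (α a) i + δ (α a) j) (λ a a≢i a≢j →
           trans (cong (λ b → δᶜ (α b) (β (α a))) (β-other a≢i a≢j)) (δᶜ-β (α a)))) ⟩
    X + X + (∑[ a ∈ allFin n ] outside a * (δ (α a) i + δ (α a) j))
      ≡⟨ cong (X + X +_) (trans (∑-cong (allFin n) (λ a → *-distribˡ-+ (outside a) (δ (α a) i) (δ (α a) j)))
                                (∑-distrib-+ (allFin n) _ _)) ⟩
    X + X + ((∑[ a ∈ allFin n ] outside a * δ (α a) i) + (∑[ a ∈ allFin n ] outside a * δ (α a) j))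
      ≡⟨ cong (X + X +_) (cong₂ _+_ (preimages-outside i) (preimages-outside j)) ⟩
    X + X + ((1 ∸ (δ (α i) i + δ (α j) i)) + (1 ∸ (δ (α i) j + δ (α j) j)))
      ≡⟨ rearrange X (1 ∸ (δ (α i) i + δ (α j) i)) (1 ∸ (δ (α i) j + δ (α j) j)) ⟩
    commutatorHamming (α i) (α j) ∎
    where
    open ≡-Reasoning

    disagree? : Decidable (λ a → α (β a) ≢ β (α a))
    disagree? a = ¬? (α (β a) ≟ β (α a))

    disagree : Fin n → ℕ
    disagree a = δᶜ (α (β a)) (β (α a))

    X : ℕ
    X = δᶜ (α j) (β (α i))

    preimages-outside : ∀ t → ∑[ a ∈ allFin n ] outside a * δ (α a) t ≡ 1 ∸ (δ (α i) t + δ (α j) t)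
    preimages-outside t = sym (trans
      (cong (_∸ (δ (α i) t + δ (α j) t)) (trans (sym (∑-δ-injective n α α-inj t)) (∑-split (λ a → δ (α a) t))))
      (m+n∸m≡n (δ (α i) t + δ (α j) t) _))

    rearrange : ∀ x a b → x + x + (a + b) ≡ a + b + 2 * x
    rearrange = solve-∀

  commutatorHamming-i-j : commutatorHamming i j ≡ 0
  commutatorHamming-i-j rewrite δ-refl i | δ-≢ (i≢j ∘ sym) | δ-≢ i≢j | δ-refl j | β-i | δᶜ-refl j = refl

  commutatorHamming-j-i : commutatorHamming j i ≡ 0
  commutatorHamming-j-i rewrite δ-refl i | δ-≢ (i≢j ∘ sym) | δ-≢ i≢j | δ-refl j | β-j | δᶜ-refl i = refl

  commutatorHamming-i-y : ∀ {y} → y ≢ i → y ≢ j → commutatorHamming i y ≡ 3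
  commutatorHamming-i-y y≢i y≢j rewrite δ-refl i | δ-≢ y≢i | δ-≢ i≢j | δ-≢ y≢j | β-i | δᶜ-≢ y≢j = refl

  commutatorHamming-j-y : ∀ {y} → y ≢ i → y ≢ j → commutatorHamming j y ≡ 3
  commutatorHamming-j-y y≢i y≢j rewrite δ-refl j | δ-≢ y≢i | δ-≢ (i≢j ∘ sym) | δ-≢ y≢j | β-j | δᶜ-≢ y≢i = refl

  commutatorHamming-x-i : ∀ {x} → x ≢ i → x ≢ j → commutatorHamming x i ≡ 3
  commutatorHamming-x-i x≢i x≢j
    rewrite δ-refl i | δ-≢ x≢i | δ-≢ i≢j | δ-≢ x≢j | β-other x≢i x≢j | δᶜ-≢ (x≢i ∘ sym) = refl

  commutatorHamming-x-j : ∀ {x} → x ≢ i → x ≢ j → commutatorHamming x j ≡ 3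
  commutatorHamming-x-j x≢i x≢j
    rewrite δ-refl j | δ-≢ x≢i | δ-≢ (i≢j ∘ sym) | δ-≢ x≢j | β-other x≢i x≢j | δᶜ-≢ (x≢j ∘ sym) = refl

  commutatorHamming-x-y : ∀ {x y} → x ≢ i → x ≢ j → y ≢ i → y ≢ j → x ≢ y → commutatorHamming x y ≡ 4
  commutatorHamming-x-y x≢i x≢j y≢i y≢j x≢y
    rewrite δ-≢ x≢i | δ-≢ x≢j | δ-≢ y≢i | δ-≢ y≢j | β-other x≢i x≢j | δᶜ-≢ (x≢y ∘ sym) = refl

  pairWeight : ∀ k {x y h} → x ≢ y → commutatorHamming x y ≡ h → δᶜ x y * δℕ (commutatorHamming x y) k ≡ δℕ h k
  pairWeight k x≢y refl rewrite δᶜ-≢ x≢y = +-identityʳ _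

  row : ℕ → Fin n → ℕ
  row k x = ∑[ y ∈ allFin n ] δᶜ x y * δℕ (commutatorHamming x y) k

  pairCount : ℕ → ℕ
  pairCount k = ∑ (allFin n) (row k)

  row-i : ∀ k → row k i ≡ δℕ 0 k + (n ∸ 2) * δℕ 3 k
  row-i k = trans (∑-split _) (cong₂ _+_
    (cong₂ _+_ (cong (_* δℕ (commutatorHamming i i) k) (δᶜ-refl i)) (pairWeight k i≢j commutatorHamming-i-j))
    (∑-outside-const _ (δℕ 3 k) (λ y y≢i y≢j → pairWeight k (y≢i ∘ sym) (commutatorHamming-i-y y≢i y≢j))))

  row-j : ∀ k → row k j ≡ δℕ 0 k + (n ∸ 2) * δℕ 3 k
  row-j k = trans (∑-split _) (cong₂ _+_
    (trans (cong₂ _+_ (pairWeight k (i≢j ∘ sym) commutatorHamming-j-i) (cong (_* δℕ (commutatorHamming j j) k) (δᶜ-refl j)))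
           (+-identityʳ (δℕ 0 k)))
    (∑-outside-const _ (δℕ 3 k) (λ y y≢i y≢j → pairWeight k (y≢j ∘ sym) (commutatorHamming-j-y y≢i y≢j))))

  ∑-outside-δᶜ : ∀ {x} → x ≢ i → x ≢ j → ∑[ y ∈ allFin n ] outside y * δᶜ x y ≡ n ∸ 2 ∸ 1
  ∑-outside-δᶜ {x} x≢i x≢j = sym (begin
    n ∸ 2 ∸ 1
      ≡⟨ cong (_∸ 1) (sym ∑-outside) ⟩
    ∑ (allFin n) outside ∸ 1
      ≡⟨ cong (_∸ 1) (trans (∑-cong (allFin n) split) (∑-distrib-+ (allFin n) _ _)) ⟩
    (∑[ y ∈ allFin n ] δ x y * outside y) + (∑[ y ∈ allFin n ] outside y * δᶜ x y) ∸ 1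
      ≡⟨ cong (λ t → t + (∑[ y ∈ allFin n ] outside y * δᶜ x y) ∸ 1)
              (trans (∑-δˡ n x outside) (cong₂ _*_ (δᶜ-≢ x≢i) (δᶜ-≢ x≢j))) ⟩
    1 + (∑[ y ∈ allFin n ] outside y * δᶜ x y) ∸ 1
      ≡⟨ m+n∸m≡n 1 _ ⟩
    ∑[ y ∈ allFin n ] outside y * δᶜ x y ∎)
    where
    open ≡-Reasoning
    split : ∀ y → outside y ≡ δ x y * outside y + outside y * δᶜ x y
    split y = sym (begin
      δ x y * outside y + outside y * δᶜ x y ≡⟨ cong (_+ outside y * δᶜ x y) (*-comm (δ x y) (outside y)) ⟩
      outside y * δ x y + outside y * δᶜ x y ≡⟨ sym (*-distribˡ-+ (outside y) (δ x y) (δᶜ x y)) ⟩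
      outside y * (δ x y + δᶜ x y)           ≡⟨ cong (outside y *_) (δ+δᶜ≡1 x y) ⟩
      outside y * 1                          ≡⟨ *-identityʳ (outside y) ⟩
      outside y                              ∎)

  row-outside : ∀ k {x} → x ≢ i → x ≢ j → row k x ≡ δℕ 3 k + δℕ 3 k + (n ∸ 2 ∸ 1) * δℕ 4 k
  row-outside k {x} x≢i x≢j = begin
    row k x
      ≡⟨ ∑-split _ ⟩
    δᶜ x i * δℕ (commutatorHamming x i) k + δᶜ x j * δℕ (commutatorHamming x j) k
      + (∑[ y ∈ allFin n ] outside y * (δᶜ x y * δℕ (commutatorHamming x y) k))
      ≡⟨ cong₂ _+_ (cong₂ _+_ (pairWeight k x≢i (commutatorHamming-x-i x≢i x≢j))
                              (pairWeight k x≢j (commutatorHamming-x-j x≢i x≢j)))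
                   (∑-outside-cong _ (λ y → δᶜ x y * δℕ 4 k) weight-outside) ⟩
    δℕ 3 k + δℕ 3 k + (∑[ y ∈ allFin n ] outside y * (δᶜ x y * δℕ 4 k))
      ≡⟨ cong (δℕ 3 k + δℕ 3 k +_) (trans (∑-cong (allFin n) (λ y → sym (*-assoc (outside y) (δᶜ x y) (δℕ 4 k))))
                                         (∑-*ʳ (allFin n) (δℕ 4 k) (λ y → outside y * δᶜ x y))) ⟩
    δℕ 3 k + δℕ 3 k + (∑[ y ∈ allFin n ] outside y * δᶜ x y) * δℕ 4 k
      ≡⟨ cong (λ t → δℕ 3 k + δℕ 3 k + t * δℕ 4 k) (∑-outside-δᶜ x≢i x≢j) ⟩
    δℕ 3 k + δℕ 3 k + (n ∸ 2 ∸ 1) * δℕ 4 k ∎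
    where
    open ≡-Reasoning
    weight-outside : ∀ y → y ≢ i → y ≢ j → δᶜ x y * δℕ (commutatorHamming x y) k ≡ δᶜ x y * δℕ 4 k
    weight-outside y y≢i y≢j with x ≟ y
    ... | yes _   = refl
    ... | no x≢y  = cong (λ h → 1 * δℕ h k) (commutatorHamming-x-y x≢i x≢j y≢i y≢j x≢y)

  pairCount-formula : ∀ k → pairCount k ≡ 2 * δℕ 0 k + 4 * (n ∸ 2) * δℕ 3 k + (n ∸ 2) * (n ∸ 3) * δℕ 4 k
  pairCount-formula k = begin
    pairCount k
      ≡⟨ ∑-split (row k) ⟩
    row k i + row k j + (∑[ x ∈ allFin n ] outside x * row k x)
      ≡⟨ cong₂ _+_ (cong₂ _+_ (row-i k) (row-j k)) (∑-outside-const (row k) _ (λ _ → row-outside k)) ⟩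
    (e₀ + (n ∸ 2) * e₃) + (e₀ + (n ∸ 2) * e₃) + (n ∸ 2) * (e₃ + e₃ + (n ∸ 2 ∸ 1) * e₄)
      ≡⟨ cong (λ t → (e₀ + (n ∸ 2) * e₃) + (e₀ + (n ∸ 2) * e₃) + (n ∸ 2) * (e₃ + e₃ + t * e₄))
              (∸-+-assoc n 2 1) ⟩
    (e₀ + (n ∸ 2) * e₃) + (e₀ + (n ∸ 2) * e₃) + (n ∸ 2) * (e₃ + e₃ + (n ∸ 3) * e₄)
      ≡⟨ collect e₀ e₃ e₄ (n ∸ 2) (n ∸ 3) ⟩
    2 * e₀ + 4 * (n ∸ 2) * e₃ + (n ∸ 2) * (n ∸ 3) * e₄ ∎
    where
    open ≡-Reasoning
    e₀ e₃ e₄ : ℕ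
    e₀ = δℕ 0 k
    e₃ = δℕ 3 k
    e₄ = δℕ 4 k
    collect : ∀ a b c r s → (a + r * b) + (a + r * b) + r * (b + b + s * c) ≡ 2 * a + 4 * r * b + r * s * c
    collect = solve-∀

  pairCount-0 : pairCount 0 ≡ 2
  pairCount-0 = trans (pairCount-formula 0) (simplify (n ∸ 2) (n ∸ 3))
    where
    simplify : ∀ r s → 2 * 1 + 4 * r * 0 + r * s * 0 ≡ 2
    simplify = solve-∀

  pairCount-3 : pairCount 3 ≡ 4 * (n ∸ 2)
  pairCount-3 = trans (pairCount-formula 3) (simplify (n ∸ 2) (n ∸ 3))
    where
    simplify : ∀ r s → 2 * 0 + 4 * r * 1 + r * s * 0 ≡ 4 * r
    simplify = solve-∀

  pairCount-4 : pairCount 4 ≡ (n ∸ 2) * (n ∸ 3)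
  pairCount-4 = trans (pairCount-formula 4) (simplify (n ∸ 2) (n ∸ 3))
    where
    simplify : ∀ r s → 2 * 0 + 4 * r * 0 + r * s * 1 ≡ r * s
    simplify = solve-∀

  pairCount-≥5 : ∀ {k} → 5 ≤ k → pairCount k ≡ 0
  pairCount-≥5 {k} 5≤k rewrite pairCount-formula k
    | δℕ-< {0} (≤-trans (s≤s z≤n) 5≤k) | δℕ-< {3} (≤-trans (s≤s (s≤s (s≤s (s≤s z≤n)))) 5≤k) | δℕ-< {4} 5≤k
    = simplify (n ∸ 2) (n ∸ 3)
    where
    simplify : ∀ r s → 2 * 0 + 4 * r * 0 + r * s * 0 ≡ 0
    simplify = solve-∀

c-transposition : ∀ m (i j : Fin (suc (suc m))) (i≢j : i ≢ j) (k : ℕ) →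
                  c k (transpose i j) ≡ Transposition.pairCount i j i≢j k * m !
c-transposition m i j i≢j k = begin
  c k β
    ≡⟨ c-as-∑ k β ⟩
  ∑[ v ∈ Vs ] 𝟙 (distinctᵇ v) * δℕ (hamming (lookup v ∘ β) (β ∘ lookup v)) k
    ≡⟨ ∑-cong Vs via-commutatorHamming ⟩
  ∑[ v ∈ Vs ] 𝟙 (distinctᵇ v) * δℕ (commutatorHamming (lookup v i) (lookup v j)) k
    ≡⟨ ∑-perm-two-values m i j i≢j (λ x y → δℕ (commutatorHamming x y) k) ⟩
  pairCount k * m ! ∎
  where
  open ≡-Reasoning
  open Transposition i j i≢j
  Vs : List (Vec (Fin (suc (suc m))) (suc (suc m)))
  Vs = vecsOver (allFin (suc (suc m))) (suc (suc m))

  via-commutatorHamming : ∀ v → 𝟙 (distinctᵇ v) * δℕ (hamming (lookup v ∘ β) (β ∘ lookup v)) k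
                                ≡ 𝟙 (distinctᵇ v) * δℕ (commutatorHamming (lookup v i) (lookup v j)) k
  via-commutatorHamming v with distinctᵇ v in dist
  ... | false = refl
  ... | true  = cong (λ h → 1 * δℕ h k) (hamming-commutator (lookup v) (distinctᵇ⇒lookup-injective v dist))

proposition18 : (n : ℕ) (i j : Fin n) → i ≢ j →
    ((n > 1 → c 0 (transpose i j) ≡ 2 * ((n ∸ 2) !))
    × (n > 1 → c 3 (transpose i j) ≡ 4 * (n ∸ 2) * ((n ∸ 2) !))
    × (n > 2 → c 4 (transpose i j) ≡ (n ∸ 2) * (n ∸ 3) * ((n ∸ 2) !))
    × ((k : ℕ) → 5 ≤ k → k ≤ n → c k (transpose i j) ≡ 0))
proposition18 (suc zero)    zero zero i≢j = ⊥-elim (i≢j refl)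
proposition18 (suc (suc m)) i    j    i≢j =
    (λ _ → trans (c-transposition m i j i≢j 0) (cong (_* m !) pairCount-0))
  , (λ _ → trans (c-transposition m i j i≢j 3) (cong (_* m !) pairCount-3))
  , (λ _ → trans (c-transposition m i j i≢j 4) (cong (_* m !) pairCount-4))
  , (λ k 5≤k _ → trans (c-transposition m i j i≢j k) (cong (_* m !) (pairCount-≥5 5≤k)))
  where open Transposition i j i≢j
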